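{- Let $G$ be a countable tournament. Then there exist a countable linearly ordered set $\mathcal Q$ and pairwise vertex-disjoint nonempty induced subtournaments $\{G_i\}_{i\in\mathcal Q}$ of $G$ such that $G=\bigoplus_{i\in\mathcal Q}G_i$ and each $G_i$ is irreducible. Furthermore, this decomposition is unique up to order isomorphism of $\mathcal Q$: if $G$ is isomorphic to $\bigoplus_{j\in\mathcal Q'}G'_j$ with $\mathcal Q'$ a countable linearly ordered set and each $G'_j$ a nonempty irreducible tournament, then there is an order isomorphism $\phi:\mathcal Q\to\mathcal Q'$ such that $G_i\cong G'_{\phi(i)}$ for all $i\in\mathcal Q$.
   Context: A tournament is a digraph without loops in which for every two distinct vertices $u,v$ exactly one of $(u,v),(v,u)$ is an edge; countable means finite or countably infinite vertex set. For a countable linearly ordered set $\mathcal Q$ and countable tournaments $G_i$, $\bigoplus_{i\in\mathcal Q}G_i$ is the tournament on $\bigsqcup_iV(G_i)$ with edge set $\bigcup_iE(G_i)\cup\bigcup_{i<j}\{(v,w):v\in V(G_i),w\in V(G_j)\}$. A countable tournament $G$ is reducible if there exist nonempty vertex-disjoint induced subtournaments $G_1,G_2$ with $V(G_1)\cup V(G_2)=V(G)$ and $G=G_1\oplus G_2$; otherwise it is irreducible. -}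

module Defs where

open import Level using (0ℓ)
open import Data.Nat using (ℕ)
open import Data.Bool using (Bool; true; false)
open import Data.Product using (Σ; ∃; ∃-syntax; _×_; _,_; proj₁; proj₂)
open import Data.Sum using (_⊎_)
open import Relation.Nullary using (¬_)
open import Relation.Binary.PropositionalEquality using (_≡_; _≢_; subst)
open import Function.Bundles using (_↔_; _⇔_; Inverse)
open import Function.Definitions using (Injective)

Countable : Set → Set
Countable A = Σ (A → ℕ) (λ f → Injective _≡_ _≡_ f)

record Tournament : Set₁ where
  field
    V        : Set
    _⇒_      : V → V → Set
    loopless : ∀ v → ¬ (v ⇒ v)
    total    : ∀ u v → u ≢ v → (u ⇒ v) ⊎ (v ⇒ u)
    asym     : ∀ u v → u ⇒ v → ¬ (v ⇒ u)
open Tournament public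

record LinOrder : Set₁ where
  field
    Carrier : Set
    _<_     : Carrier → Carrier → Set
    irrefl  : ∀ i → ¬ (i < i)
    trans   : ∀ {i j k} → i < j → j < k → i < k
    connex  : ∀ i j → i ≢ j → (i < j) ⊎ (j < i)
open LinOrder public

-- Reducibility of a digraph (A , R) (used for tournaments and induced
-- subtournaments): a partition of the vertex set into a nonempty part G₁
-- (S = false) and a nonempty part G₂ (S = true) with every vertex of G₁
-- sending an edge to every vertex of G₂, i.e. G = G₁ ⊕ G₂.
Reducible : (A : Set) → (A → A → Set) → Set
Reducible A R =
  Σ (A → Bool) λ S →
    (∃[ a ] S a ≡ false) × (∃[ b ] S b ≡ true) ×
    (∀ a b → S a ≡ false → S b ≡ true → R a b)

Irreducible : (A : Set) → (A → A → Set) → Set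
Irreducible A R = ¬ Reducible A R

DiIso : (A : Set) → (A → A → Set) → (B : Set) → (B → B → Set) → Set
DiIso A R B S = Σ (A ↔ B) λ f →
  ∀ a b → R a b ⇔ S (Inverse.to f a) (Inverse.to f b)

_≅_ : Tournament → Tournament → Set
G ≅ H = DiIso (V G) (_⇒_ G) (V H) (_⇒_ H)

OrderIso : (Q Q' : LinOrder) → (Carrier Q ↔ Carrier Q') → Set
OrderIso Q Q' φ = ∀ i j → _<_ Q i j ⇔ _<_ Q' (Inverse.to φ i) (Inverse.to φ j)

⊕V : (Q : LinOrder) → (Carrier Q → Tournament) → Set
⊕V Q G = Σ (Carrier Q) (λ i → V (G i))

⊕E : (Q : LinOrder) (G : Carrier Q → Tournament) → ⊕V Q G → ⊕V Q G → Set
⊕E Q G (i , x) (j , y) =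
  _<_ Q i j ⊎ Σ (i ≡ j) (λ p → _⇒_ (G j) (subst (λ k → V (G k)) p x) y)

-- Vertex set of the induced subtournament G_i = G[c⁻¹(i)] of a decomposition
-- given by a block map c : V G → Q, and its (inherited) edge relation.
Block : (G : Tournament) {Q : Set} → (V G → Q) → Q → Set
Block G c i = Σ (V G) (λ v → c v ≡ i)

BlockE : (G : Tournament) {Q : Set} (c : V G → Q) (i : Q) →
         Block G c i → Block G c i → Set
BlockE G c i (u , _) (w , _) = _⇒_ G u w

-- G = ⊕_{i ∈ Q} G_i where the G_i are the induced subtournaments on the
-- blocks c⁻¹(i): the blocks are pairwise disjoint and cover V G (c is a
-- function), each block is nonempty, and every edge between different blocks
-- goes from the lower block to the higher one (edges inside blocks are those
-- of G since the G_i are induced).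
IsOrderedDecomposition : (G : Tournament) (Q : LinOrder) → (V G → Carrier Q) → Set
IsOrderedDecomposition G Q c =
  (∀ i → ∃[ v ] c v ≡ i) ×
  (∀ u w → _<_ Q (c u) (c w) → _⇒_ G u w)

-- Call vertices u and w inseparable if every cut (a two-sided partition with
-- all edges going from the lower to the upper side) puts them on the same side.
-- The inseparability classes are the irreducible components: "some cut puts
-- the class of u below that of w" is a linear order (intersecting two cuts
-- gives a cut, and asymmetry of the tournament makes this transitive), every
-- edge between different classes goes upward, and a cut of a single class
-- extends to a cut of G by putting the lower classes below and the upper ones
-- above, so no class is reducible. Countability provides canonical
-- representatives (least index), making the classes a type. For uniqueness,
-- in a sum of irreducible tournaments two vertices are inseparable iff they lie
-- in the same summand and separated iff their summands are ordered; both
-- notions are invariant under isomorphism.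

module Submission where

open import Defs hiding (trans)
open import Level using (0ℓ)
open import Axiom.ExcludedMiddle using (ExcludedMiddle)
open import Axiom.UniquenessOfIdentityProofs using (UIP; module Decidable⇒UIP)
open import Data.Bool using (Bool; true; false; _∧_)
open import Data.Empty using (⊥-elim)
open import Data.Nat using () renaming (_<_ to _<ℕ_)
open import Data.Nat.Induction using (<-wellFounded)
open import Data.Nat.Properties using (<-cmp)
open import Data.Product using (Σ; ∃-syntax; _×_; _,_; proj₁; proj₂)
open import Data.Product.Properties using (Σ-≡,≡→≡)
open import Data.Sum using (_⊎_; inj₁; inj₂)
open import Function using (_∘_)
open import Function.Bundles using (_↔_; _⇔_; Inverse; Equivalence; mk⇔; mk↔ₛ′)
open import Function.Construct.Composition using (_↔-∘_; _⇔-∘_)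
open import Induction.WellFounded using (Acc; acc)
open import Relation.Binary using (IsEquivalence; tri<; tri≈; tri>)
open import Relation.Binary.PropositionalEquality
  using (_≡_; _≢_; refl; sym; trans; cong; cong₂; subst; subst₂; module ≡-Reasoning)
open import Relation.Nullary using (¬_; Dec; yes; no; Irrelevant)
open import Relation.Nullary.Decidable using (isNo)

uip : ExcludedMiddle 0ℓ → {A : Set} → UIP A
uip lem = Decidable⇒UIP.≡-irrelevant (λ _ _ → lem)

subtype-≡ : {A : Set} {P : A → Set} → (∀ {a} → Irrelevant (P a)) →
            {p q : Σ A P} → proj₁ p ≡ proj₁ q → p ≡ q
subtype-≡ irrelevant e = Σ-≡,≡→≡ (e , irrelevant _ _)

false≢true : false ≢ true
false≢true ()

≡-or-separated : ∀ x y → x ≡ y ⊎ (x ≡ false × y ≡ true) ⊎ (x ≡ true × y ≡ false)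
≡-or-separated false false = inj₁ refl
≡-or-separated true  true  = inj₁ refl
≡-or-separated false true  = inj₂ (inj₁ (refl , refl))
≡-or-separated true  false = inj₂ (inj₂ (refl , refl))

module _ {P : Set} where

  isNo≡false⇒ : (d : Dec P) → isNo d ≡ false → P
  isNo≡false⇒ (yes p) _ = p
  isNo≡false⇒ (no _)  ()

  isNo≡true⇒ : (d : Dec P) → isNo d ≡ true → ¬ P
  isNo≡true⇒ (yes _)  ()
  isNo≡true⇒ (no ¬p) _ = ¬p

  isNo≡false : (d : Dec P) → P → isNo d ≡ false
  isNo≡false (yes _)  _ = refl
  isNo≡false (no ¬p) p = ⊥-elim (¬p p)

  isNo≡true : (d : Dec P) → ¬ P → isNo d ≡ true
  isNo≡true (yes p) ¬p = ⊥-elim (¬p p)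
  isNo≡true (no _)  _  = refl

trichotomy : ExcludedMiddle 0ℓ → (Q : LinOrder) → ∀ i j →
             _<_ Q i j ⊎ i ≡ j ⊎ _<_ Q j i
trichotomy lem Q i j with lem {i ≡ j}
... | yes i≡j = inj₂ (inj₁ i≡j)
... | no  i≢j with connex Q i j i≢j
...   | inj₁ i<j = inj₁ i<j
...   | inj₂ j<i = inj₂ (inj₂ j<i)

<∧≮⇒< : ExcludedMiddle 0ℓ → (Q : LinOrder) → ∀ {i j k} →
        _<_ Q i k → ¬ _<_ Q j k → _<_ Q i j
<∧≮⇒< lem Q {i} {j} {k} i<k j≮k with trichotomy lem Q i j
... | inj₁ i<j         = i<j
... | inj₂ (inj₁ refl) = ⊥-elim (j≮k i<k)
... | inj₂ (inj₂ j<i)  = ⊥-elim (j≮k (LinOrder.trans Q j<i i<k))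

module Cuts {A : Set} (_⇒_ : A → A → Set) where

  Cut : (A → Bool) → Set
  Cut S = ∀ a b → S a ≡ false → S b ≡ true → a ⇒ b

  Inseparable : A → A → Set
  Inseparable u w = ∀ S → Cut S → S u ≡ S w

  Separated : A → A → Set
  Separated u w = ∃[ S ] Cut S × S u ≡ false × S w ≡ true

  inseparable-isEquivalence : IsEquivalence Inseparable
  inseparable-isEquivalence = record
    { refl  = λ _ _ → refl
    ; sym   = λ u≈w S cut → sym (u≈w S cut)
    ; trans = λ u≈w w≈x S cut → trans (u≈w S cut) (w≈x S cut)
    }

  open IsEquivalence inseparable-isEquivalence public using ()
    renaming (refl to inseparable-refl; sym to inseparable-sym; trans to inseparable-trans)

  separated⇒edge : ∀ {u w} → Separated u w → u ⇒ w
  separated⇒edge (S , cut , Su , Sw) = cut _ _ Su Sw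

  separated⇒¬inseparable : ∀ {u w} → Separated u w → ¬ Inseparable u w
  separated⇒¬inseparable (S , cut , Su , Sw) u≈w =
    false≢true (trans (sym Su) (trans (u≈w S cut) Sw))

  separated-irrefl : ∀ {u} → ¬ Separated u u
  separated-irrefl s = separated⇒¬inseparable s inseparable-refl

  separated-respˡ : ∀ {u u' w} → Inseparable u u' → Separated u w → Separated u' w
  separated-respˡ u≈u' (S , cut , Su , Sw) = S , cut , trans (sym (u≈u' S cut)) Su , Sw

  separated-respʳ : ∀ {u w w'} → Inseparable w w' → Separated u w → Separated u w'
  separated-respʳ w≈w' (S , cut , Su , Sw) = S , cut , Su , trans (sym (w≈w' S cut)) Sw

  ∧-cut : ∀ {S₁ S₂} → Cut S₁ → Cut S₂ → Cut (λ v → S₁ v ∧ S₂ v)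
  ∧-cut {S₁} cut₁ cut₂ a b Sa Sb with S₁ a in S₁a | S₁ b in S₁b
  ∧-cut cut₁ cut₂ a b Sa Sb | false | true  = cut₁ a b S₁a S₁b
  ∧-cut cut₁ cut₂ a b Sa Sb | true  | true  = cut₂ a b Sa Sb
  ∧-cut cut₁ cut₂ a b Sa () | _     | false

  separated-trans : (∀ {a b} → a ⇒ b → ¬ b ⇒ a) →
                    ∀ {u w x} → Separated u w → Separated w x → Separated u x
  separated-trans asym {u} {w} {x} (S₁ , cut₁ , S₁u , S₁w) (S₂ , cut₂ , S₂w , S₂x) =
    (λ v → S₁ v ∧ S₂ v) , ∧-cut cut₁ cut₂ , cong (_∧ S₂ u) S₁u , cong₂ _∧_ S₁x S₂x
    where
    -- otherwise S₁ and S₂ would give edges w ⇒ x and x ⇒ w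
    S₁x : S₁ x ≡ true
    S₁x with S₁ x in e
    ... | true  = refl
    ... | false = ⊥-elim (asym (cut₁ x w e S₁w) (cut₂ w x S₂w S₂x))

  cut-agrees-or-separates : ∀ {S} → Cut S → ∀ u w →
                            S u ≡ S w ⊎ Separated u w ⊎ Separated w u
  cut-agrees-or-separates {S} cut u w with ≡-or-separated (S u) (S w)
  ... | inj₁ Su≡Sw               = inj₁ Su≡Sw
  ... | inj₂ (inj₁ (Su , Sw))    = inj₂ (inj₁ (S , cut , Su , Sw))
  ... | inj₂ (inj₂ (Su , Sw))    = inj₂ (inj₂ (S , cut , Sw , Su))

  inseparable-or-separated : ExcludedMiddle 0ℓ → ∀ u w →
                             Inseparable u w ⊎ Separated u w ⊎ Separated w u
  inseparable-or-separated lem u w with lem {Separated u w} | lem {Separated w u}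
  ... | yes uw  | _       = inj₂ (inj₁ uw)
  ... | no _    | yes wu  = inj₂ (inj₂ wu)
  ... | no ¬uw  | no ¬wu  = inj₁ λ S cut → agree {S} (cut-agrees-or-separates cut u w)
    where
    agree : ∀ {S} → S u ≡ S w ⊎ Separated u w ⊎ Separated w u → S u ≡ S w
    agree (inj₁ Su≡Sw)      = Su≡Sw
    agree (inj₂ (inj₁ uw)) = ⊥-elim (¬uw uw)
    agree (inj₂ (inj₂ wu)) = ⊥-elim (¬wu wu)

  separated⇒reducible : ∀ {u w} → Separated u w → Reducible A _⇒_
  separated⇒reducible (S , cut , Su , Sw) = S , (_ , Su) , (_ , Sw) , cut

  irreducible⇒inseparable : Irreducible A _⇒_ → ∀ u w → Inseparable u w
  irreducible⇒inseparable irr u w S cut with cut-agrees-or-separates cut u w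
  ... | inj₁ Su≡Sw      = Su≡Sw
  ... | inj₂ (inj₁ uw) = ⊥-elim (irr (separated⇒reducible uw))
  ... | inj₂ (inj₂ wu) = ⊥-elim (irr (separated⇒reducible wu))

  inseparable⇒irreducible : (∀ u w → Inseparable u w) → Irreducible A _⇒_
  inseparable⇒irreducible all (S , (a , Sa) , (b , Sb) , cut) =
    separated⇒¬inseparable (S , cut , Sa , Sb) (all a b)

module _ {A B : Set} {R : A → A → Set} {S : B → B → Set} (h : DiIso A R B S) where
  open Inverse (proj₁ h)
  private
    module R = Cuts R
    module S = Cuts S

    edge⇒ : ∀ {a b} → R a b → S (to a) (to b)
    edge⇒ = Equivalence.to (proj₂ h _ _)

    edge⇐ : ∀ {a b} → S (to a) (to b) → R a b
    edge⇐ = Equivalence.from (proj₂ h _ _)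

  cut-pullback : ∀ {T} → S.Cut T → R.Cut (T ∘ to)
  cut-pullback cut a b Ta Tb = edge⇐ (cut (to a) (to b) Ta Tb)

  cut-pushforward : ∀ {U} → R.Cut U → S.Cut (U ∘ from)
  cut-pushforward cut x y Ux Uy =
    subst₂ S (strictlyInverseˡ x) (strictlyInverseˡ y) (edge⇒ (cut (from x) (from y) Ux Uy))

  inseparable-transport : ∀ {u w} → R.Inseparable u w ⇔ S.Inseparable (to u) (to w)
  inseparable-transport {u} {w} = mk⇔
    (λ u≈w T cut → u≈w (T ∘ to) (cut-pullback cut))
    (λ tu≈tw U cut → subst₂ (λ u' w' → U u' ≡ U w') (strictlyInverseʳ u) (strictlyInverseʳ w)
                       (tu≈tw (U ∘ from) (cut-pushforward cut)))

  separated-transport : ∀ {u w} → R.Separated u w ⇔ S.Separated (to u) (to w)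
  separated-transport {u} {w} = mk⇔
    (λ (U , cut , Uu , Uw) → U ∘ from , cut-pushforward cut ,
                             trans (cong U (strictlyInverseʳ u)) Uu ,
                             trans (cong U (strictlyInverseʳ w)) Uw)
    (λ (T , cut , Tu , Tw) → T ∘ to , cut-pullback cut , Tu , Tw)

DiIso-∘ : {A B C : Set} {R : A → A → Set} {S : B → B → Set} {T : C → C → Set} →
          DiIso B S C T → DiIso A R B S → DiIso A R C T
DiIso-∘ (g , g-edge) (f , f-edge) = g ↔-∘ f , λ a b → g-edge _ _ ⇔-∘ f-edge a b

Induced : {A : Set} → (A → A → Set) → (P : A → Set) → Σ A P → Σ A P → Set
Induced R P p q = R (proj₁ p) (proj₁ q)

DiIso-restrict : {A B : Set} {R : A → A → Set} {S : B → B → Set}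
                 {P : A → Set} {P' : B → Set} →
                 (∀ {a} → Irrelevant (P a)) → (∀ {b} → Irrelevant (P' b)) →
                 (h : DiIso A R B S) → (∀ a → P a ⇔ P' (Inverse.to (proj₁ h) a)) →
                 DiIso (Σ A P) (Induced R P) (Σ B P') (Induced S P')
DiIso-restrict {P = P} {P'} P-irrelevant P'-irrelevant (h , h-edge) P⇔P' =
  mk↔ₛ′ to' from' (λ q → subtype-≡ P'-irrelevant (strictlyInverseˡ (proj₁ q)))
                  (λ p → subtype-≡ P-irrelevant (strictlyInverseʳ (proj₁ p))) ,
  λ p q → h-edge (proj₁ p) (proj₁ q)
  where
  open Inverse h
  to' : Σ _ P → Σ _ P'
  to' (a , Pa) = to a , Equivalence.to (P⇔P' a) Pa
  from' : Σ _ P' → Σ _ P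
  from' (b , P'b) = from b , Equivalence.from (P⇔P' (from b)) (subst P' (sym (strictlyInverseˡ b)) P'b)

module CanonicalRepresentatives (lem : ExcludedMiddle 0ℓ) {A : Set} {_≈_ : A → A → Set}
  (≈-isEquivalence : IsEquivalence _≈_) (countable : Countable A) where

  open IsEquivalence ≈-isEquivalence
    renaming (refl to ≈-refl; sym to ≈-sym; trans to ≈-trans; reflexive to ≈-reflexive)

  private
    index = proj₁ countable

  HasSmallerEquivalent : A → Set
  HasSmallerEquivalent v = ∃[ w ] w ≈ v × index w <ℕ index v

  -- a Bool equation rather than a negation, so that it is proof-irrelevant
  Canonical : A → Set
  Canonical v = isNo (lem {HasSmallerEquivalent v}) ≡ true

  canonical-unique : ∀ {u w} → u ≈ w → Canonical u → Canonical w → u ≡ w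
  canonical-unique {u} {w} u≈w cu cw with <-cmp (index u) (index w)
  ... | tri< u<w _ _ = ⊥-elim (isNo≡true⇒ lem cw (u , u≈w , u<w))
  ... | tri≈ _ eq _  = proj₂ countable eq
  ... | tri> _ _ w<u = ⊥-elim (isNo≡true⇒ lem cu (w , ≈-sym u≈w , w<u))

  canonical-exists : ∀ v → Acc _<ℕ_ (index v) → ∃[ r ] r ≈ v × Canonical r
  canonical-exists v (acc smaller) with lem {HasSmallerEquivalent v}
  ... | no none = v , ≈-refl , isNo≡true lem none
  ... | yes (w , w≈v , w<v) with canonical-exists w (smaller w<v)
  ...   | r , r≈w , canonical = r , ≈-trans r≈w w≈v , canonical

  Class : Set
  Class = Σ A Canonical

  [_] : A → Class
  [ v ] with canonical-exists v (<-wellFounded (index v))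
  ... | r , _ , canonical = r , canonical

  repr : Class → A
  repr = proj₁

  repr-[] : ∀ v → repr [ v ] ≈ v
  repr-[] v with canonical-exists v (<-wellFounded (index v))
  ... | _ , r≈v , _ = r≈v

  repr-≈⇒≡ : ∀ {i j} → repr i ≈ repr j → i ≡ j
  repr-≈⇒≡ {i} {j} e = subtype-≡ (uip lem) (canonical-unique e (proj₂ i) (proj₂ j))

  []-cong : ∀ {u w} → u ≈ w → [ u ] ≡ [ w ]
  []-cong {u} {w} u≈w = repr-≈⇒≡ (≈-trans (repr-[] u) (≈-trans u≈w (≈-sym (repr-[] w))))

  [repr] : ∀ i → [ repr i ] ≡ i
  [repr] i = repr-≈⇒≡ (repr-[] (repr i))

  []≡⇔≈repr : ∀ {v i} → [ v ] ≡ i ⇔ v ≈ repr i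
  []≡⇔≈repr {v} {i} = mk⇔
    (λ v∈i → ≈-trans (≈-sym (repr-[] v)) (≈-reflexive (cong repr v∈i)))
    (λ v≈i → trans ([]-cong v≈i) ([repr] i))

  Class-countable : Countable Class
  Class-countable = index ∘ repr , subtype-≡ (uip lem) ∘ proj₂ countable

module OrderedSum (lem : ExcludedMiddle 0ℓ) (Q : LinOrder) (G : Carrier Q → Tournament) where

  open Cuts (⊕E Q G)

  index : ⊕V Q G → Carrier Q
  index = proj₁

  ⊕E-within : ∀ {j x y} → ⊕E Q G (j , x) (j , y) → _⇒_ (G j) x y
  ⊕E-within {j} (inj₁ j<j) = ⊥-elim (irrefl Q j j<j)
  ⊕E-within {j} {x} {y} (inj₂ (j≡j , e)) =
    subst (λ p → _⇒_ (G j) (subst (V ∘ G) p x) y) (uip lem j≡j refl) e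

  ⊕E-not-backwards : ∀ {p q} → ⊕E Q G p q → ¬ _<_ Q (index q) (index p)
  ⊕E-not-backwards (inj₁ i<j) j<i = irrefl Q _ (LinOrder.trans Q i<j j<i)
  ⊕E-not-backwards (inj₂ (refl , _)) j<i = irrefl Q _ j<i

  atOrAbove : Carrier Q → ⊕V Q G → Bool
  atOrAbove k p = isNo (lem {_<_ Q (index p) k})

  atOrAbove-cut : ∀ k → Cut (atOrAbove k)
  atOrAbove-cut k a b a-below b-not-below =
    inj₁ (<∧≮⇒< lem Q (isNo≡false⇒ lem a-below) (isNo≡true⇒ lem b-not-below))

  <⇒separated : ∀ {p q} → _<_ Q (index p) (index q) → Separated p q
  <⇒separated {p} {q} p<q =
    atOrAbove (index q) , atOrAbove-cut (index q) ,
    isNo≡false lem p<q , isNo≡true lem (irrefl Q (index q))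

  module _ (irreducible : ∀ j → Irreducible (V (G j)) (_⇒_ (G j))) where

    same-index⇒inseparable : ∀ {p q} → index p ≡ index q → Inseparable p q
    same-index⇒inseparable {j , x} {.j , y} refl S cut =
      Cuts.irreducible⇒inseparable (_⇒_ (G j)) (irreducible j) x y
        (λ z → S (j , z)) (λ a b Sa Sb → ⊕E-within (cut _ _ Sa Sb))

    ⊕-inseparable⇔ : ∀ {p q} → Inseparable p q ⇔ index p ≡ index q
    ⊕-inseparable⇔ {p} {q} = mk⇔ same-index same-index⇒inseparable
      where
      same-index : Inseparable p q → index p ≡ index q
      same-index p≈q with trichotomy lem Q (index p) (index q)
      ... | inj₁ p<q        = ⊥-elim (separated⇒¬inseparable (<⇒separated p<q) p≈q)
      ... | inj₂ (inj₁ p≡q) = p≡q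
      ... | inj₂ (inj₂ q<p) = ⊥-elim (separated⇒¬inseparable (<⇒separated q<p) (inseparable-sym p≈q))

    ⊕-separated⇔ : ∀ {p q} → Separated p q ⇔ _<_ Q (index p) (index q)
    ⊕-separated⇔ {p} {q} = mk⇔ ordered <⇒separated
      where
      ordered : Separated p q → _<_ Q (index p) (index q)
      ordered s with trichotomy lem Q (index p) (index q)
      ... | inj₁ p<q        = p<q
      ... | inj₂ (inj₁ p≡q) = ⊥-elim (separated⇒¬inseparable s (same-index⇒inseparable p≡q))
      ... | inj₂ (inj₂ q<p) = ⊥-elim (⊕E-not-backwards (separated⇒edge s) q<p)

  fibre-iso : ∀ k → DiIso (Σ (⊕V Q G) (λ p → index p ≡ k)) (Induced (⊕E Q G) (λ p → index p ≡ k))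
                          (V (G k)) (_⇒_ (G k))
  fibre-iso k = mk↔ₛ′ to from (λ _ → refl) from∘to , edges
    where
    to : Σ (⊕V Q G) (λ p → index p ≡ k) → V (G k)
    to ((j , x) , j≡k) = subst (V ∘ G) j≡k x
    from : V (G k) → Σ (⊕V Q G) (λ p → index p ≡ k)
    from x = (k , x) , refl
    from∘to : ∀ p → from (to p) ≡ p
    from∘to (_ , refl) = refl
    edges : ∀ p q → Induced (⊕E Q G) (λ p → index p ≡ k) p q ⇔ _⇒_ (G k) (to p) (to q)
    edges (_ , refl) (_ , refl) = mk⇔ ⊕E-within (λ e → inj₂ (refl , e))

module Components (lem : ExcludedMiddle 0ℓ) (G : Tournament) (countable : Countable (V G)) where

  open Cuts (_⇒_ G)
  open CanonicalRepresentatives lem inseparable-isEquivalence countable public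

  component : V G → Class
  component = [_]

  _≺_ : Class → Class → Set
  i ≺ j = Separated (repr i) (repr j)

  ≺-connex : ∀ i j → i ≢ j → i ≺ j ⊎ j ≺ i
  ≺-connex i j i≢j with inseparable-or-separated lem (repr i) (repr j)
  ... | inj₁ i≈j = ⊥-elim (i≢j (repr-≈⇒≡ i≈j))
  ... | inj₂ s   = s

  componentOrder : LinOrder
  componentOrder = record
    { Carrier = Class
    ; _<_     = _≺_
    ; irrefl  = λ _ → separated-irrefl
    ; trans   = separated-trans (asym G _ _)
    ; connex  = ≺-connex
    }

  ≺⇒edge : ∀ u w → component u ≺ component w → _⇒_ G u w
  ≺⇒edge u w s = separated⇒edge (separated-respʳ (repr-[] w) (separated-respˡ (repr-[] u) s))

  decomposition : IsOrderedDecomposition G componentOrder component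
  decomposition = (λ i → repr i , [repr] i) , ≺⇒edge

  module ExtendCut (i : Class) (T : Block G component i → Bool)
                   (T-cut : Cuts.Cut (BlockE G component i) T) where

    side : ∀ v → Dec (component v ≡ i) → Dec (Separated v (repr i)) → Bool
    side v (yes v∈i) _     = T (v , v∈i)
    side v (no _)    (yes _) = false
    side v (no _)    (no _)  = true

    S : V G → Bool
    S v = side v lem lem

    S-extends : ∀ v (v∈i : component v ≡ i) → S v ≡ T (v , v∈i)
    S-extends v v∈i with lem {component v ≡ i}
    ... | yes v∈i' = cong (λ e → T (v , e)) (uip lem v∈i' v∈i)
    ... | no v∉i   = ⊥-elim (v∉i v∈i)

    above : ∀ {v} → component v ≢ i → ¬ Separated v (repr i) → Separated (repr i) v
    above {v} v∉i v≮i with inseparable-or-separated lem v (repr i)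
    ... | inj₁ v≈i        = ⊥-elim (v∉i (Equivalence.from []≡⇔≈repr v≈i))
    ... | inj₂ (inj₁ v<i) = ⊥-elim (v≮i v<i)
    ... | inj₂ (inj₂ i<v) = i<v

    side-cut : ∀ a b da da' db db' → side a da da' ≡ false → side b db db' ≡ true → _⇒_ G a b
    side-cut a b (yes a∈i) _ (yes b∈i) _ Ta Tb = T-cut (a , a∈i) (b , b∈i) Ta Tb
    side-cut a b (yes a∈i) _ (no b∉i) (no b≮i) _ _ =
      separated⇒edge (separated-respˡ (inseparable-sym (Equivalence.to []≡⇔≈repr a∈i)) (above b∉i b≮i))
    side-cut a b (no _) (yes a<i) (yes b∈i) _ _ _ =
      separated⇒edge (separated-respʳ (inseparable-sym (Equivalence.to []≡⇔≈repr b∈i)) a<i)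
    side-cut a b (no _) (yes a<i) (no b∉i) (no b≮i) _ _ =
      separated⇒edge (separated-trans (asym G _ _) a<i (above b∉i b≮i))
    side-cut a b (yes _) _       (no _) (yes _) _ ()
    side-cut a b (no _)  (yes _) (no _) (yes _) _ ()
    side-cut a b (no _)  (no _)  _      _       () _

    S-cut : Cut S
    S-cut a b = side-cut a b lem lem lem lem

  component-irreducible : ∀ i → Irreducible (Block G component i) (BlockE G component i)
  component-irreducible i = Cuts.inseparable⇒irreducible (BlockE G component i) block-inseparable
    where
    block-inseparable : ∀ x y → Cuts.Inseparable (BlockE G component i) x y
    block-inseparable (u , u∈i) (w , w∈i) T T-cut = begin
      T (u , u∈i)  ≡⟨ sym (S-extends u u∈i) ⟩
      S u          ≡⟨ u≈w S S-cut ⟩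
      S w          ≡⟨ S-extends w w∈i ⟩
      T (w , w∈i)  ∎
      where
      open ExtendCut i T T-cut
      open ≡-Reasoning
      u≈w : Inseparable u w
      u≈w = inseparable-trans (Equivalence.to []≡⇔≈repr u∈i)
                              (inseparable-sym (Equivalence.to []≡⇔≈repr w∈i))

module Uniqueness (lem : ExcludedMiddle 0ℓ) (G : Tournament) (countable : Countable (V G))
  (Q' : LinOrder) (G' : Carrier Q' → Tournament) (inhabited : ∀ j → V (G' j))
  (irreducible : ∀ j → Irreducible (V (G' j)) (_⇒_ (G' j)))
  (h : DiIso (V G) (_⇒_ G) (⊕V Q' G') (⊕E Q' G')) where

  open Cuts (_⇒_ G)
  open Components lem G countable
  open OrderedSum lem Q' G'
  open Inverse (proj₁ h)

  π : V G → Carrier Q'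
  π = index ∘ to

  inseparable⇔π≡ : ∀ {u w} → Inseparable u w ⇔ π u ≡ π w
  inseparable⇔π≡ = ⊕-inseparable⇔ irreducible ⇔-∘ inseparable-transport h

  separated⇔π< : ∀ {u w} → Separated u w ⇔ _<_ Q' (π u) (π w)
  separated⇔π< = ⊕-separated⇔ irreducible ⇔-∘ separated-transport h

  π-from : ∀ j x → π (from (j , x)) ≡ j
  π-from j x = cong index (strictlyInverseˡ (j , x))

  φ : Class → Carrier Q'
  φ i = π (repr i)

  ψ : Carrier Q' → Class
  ψ j = [ from (j , inhabited j) ]

  φ∘ψ : ∀ j → φ (ψ j) ≡ j
  φ∘ψ j = trans (Equivalence.to inseparable⇔π≡ (repr-[] _)) (π-from j (inhabited j))

  ψ∘φ : ∀ i → ψ (φ i) ≡ i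
  ψ∘φ i = trans ([]-cong (Equivalence.from inseparable⇔π≡ (π-from (φ i) _))) ([repr] i)

  φ↔ : Class ↔ Carrier Q'
  φ↔ = mk↔ₛ′ φ ψ φ∘ψ ψ∘φ

  φ-orderIso : OrderIso componentOrder Q' φ↔
  φ-orderIso _ _ = separated⇔π<

  component-iso : ∀ i → DiIso (Block G component i) (BlockE G component i)
                              (V (G' (φ i))) (_⇒_ (G' (φ i)))
  component-iso i = DiIso-∘ {T = _⇒_ (G' (φ i))} (fibre-iso (φ i))
    (DiIso-restrict {S = ⊕E Q' G'} (uip lem) (uip lem) h
                    (λ _ → inseparable⇔π≡ ⇔-∘ []≡⇔≈repr))

theorem3p7 : ExcludedMiddle 0ℓ →
    (G : Tournament) → Countable (V G) →
    Σ LinOrder λ Q → Countable (Carrier Q) ×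
    Σ (V G → Carrier Q) λ c →
      IsOrderedDecomposition G Q c ×
      (∀ i → Irreducible (Block G c i) (BlockE G c i)) ×
      ((Q' : LinOrder) → Countable (Carrier Q') →
       (G' : Carrier Q' → Tournament) →
       (∀ j → V (G' j)) →
       (∀ j → Irreducible (V (G' j)) (_⇒_ (G' j))) →
       DiIso (V G) (_⇒_ G) (⊕V Q' G') (⊕E Q' G') →
       Σ (Carrier Q ↔ Carrier Q') λ φ → OrderIso Q Q' φ ×
         (∀ i → DiIso (Block G c i) (BlockE G c i)
                      (V (G' (Inverse.to φ i))) (_⇒_ (G' (Inverse.to φ i)))))
theorem3p7 lem G countable =
  componentOrder , Class-countable , component , decomposition , component-irreducible ,
  λ Q' _ G' inhabited irreducible h →
    let open Uniqueness lem G countable Q' G' inhabited irreducible h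
    in φ↔ , φ-orderIso , component-iso
  where open Components lem G countable
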